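{- Let $G$ be an abelian group and $A\subseteq G$ an arbitrary subset. For all positive integers $k$ and $\ell$ there is a number $N=N(k,\ell)$ such that there are at most $N$ subsets $X\subseteq A$ with the property that each of them covers $A$ by $\ell$ translates (i.e. $A\subseteq\bigcup_{j=1}^{\ell}(g_j+X)$ for some $g_1,\dots,g_\ell\in G$) and every $k$ of them have empty intersection. -}

module Defs where

open import Level using (Level)
open import Algebra.Bundles using (AbelianGroup)
open import Data.Nat using (ℕ)
open import Data.Fin using (Fin)
open import Data.Product using (Σ; ∃; _×_)
open import Relation.Unary using (Pred; _⊆_)
open import Relation.Binary.PropositionalEquality using (_≡_; _≢_)
open import Relation.Nullary using (¬_)
open import Function.Definitions using (Injective)

module _ {c ℓ : Level} (G : AbelianGroup c ℓ) where
  open AbelianGroup G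

  record Subset (p : Level) : Set (Level.suc p Level.⊔ c Level.⊔ ℓ) where
    field
      mem  : Pred Carrier p
      resp : ∀ {x y} → x ≈ y → mem x → mem y
  open Subset public

  _+ˢ_ : ∀ {p} → Carrier → Subset p → Pred Carrier _
  (g +ˢ X) y = ∃ λ x → mem X x × y ≈ g ∙ x

  CoveredByTranslates : ∀ {p q} → ℕ → Subset q → Subset p → Set _
  CoveredByTranslates l A X =
    Σ (Fin l → Carrier) λ g → ∀ a → mem A a → ∃ λ j → (g j +ˢ X) a

  PairwiseDistinct : ∀ {p m} → (Fin m → Subset p) → Set _
  PairwiseDistinct {m = m} X =
    (i j : Fin m) → i ≢ j → ¬ ((mem (X i) ⊆ mem (X j)) × (mem (X j) ⊆ mem (X i)))

  EveryKDisjoint : ∀ {p m} → ℕ → (Fin m → Subset p) → Set _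
  EveryKDisjoint {m = m} k X =
    (f : Fin k → Fin m) → Injective _≡_ _≡_ f →
    ¬ (∃ λ x → ∀ t → mem (X (f t)) x)

-- If A has a point a, consider the points a − Σ v(i,j) g(i,j) for v ∈ ℕ^(m·l), where
-- g(i,1), …, g(i,l) are the translations covering A by X_i. Starting from v = 0, replace a finite set
-- S of such v (all giving points of A) by the set of all v + e(i,j), where for each i and v ∈ S the
-- index j is chosen so that the new point lies in X_i. For fixed i each new v comes from at most l
-- old ones, and its point lies in fewer than k of the X_i, so the new set has at least
-- m·|S| / (l·(k − 1)) elements. If m > 2·l·(k − 1) the sets double at every step, yet after n steps
-- they lie in {0, …, n}^(m·l): impossible for large n. So either m ≤ 2·l·(k − 1), or A, hence every
-- X_i, is empty and distinctness leaves at most one member. Points are counted through their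
-- coordinates v, so no decidable equality on G is needed.

module Submission where

open import Defs
open import Level using (Level)
open import Algebra.Bundles using (AbelianGroup)
open import Data.Bool.Base using (Bool; true; false; T; _∧_)
open import Data.Bool.Properties using (T-≡; T-∧)
open import Data.Empty using (⊥-elim)
open import Data.Fin.Base using (Fin; zero; suc; toℕ; fromℕ<; combine; remQuot)
open import Data.Fin.Properties using (toℕ-injective; suc-injective; toℕ-fromℕ<; remQuot-combine; combine-remQuot)
  renaming (_≟_ to _≟ᶠ_)
open import Data.Nat.Base using (ℕ; zero; suc; _+_; _*_; _∸_; _^_; _≤_; _<_; z≤n; s≤s; s≤s⁻¹; >-nonZero)
open import Data.Nat.Properties
  using ( ≤-refl; ≤-trans; ≤-reflexive; <⇒≤; ≮⇒≥; ≰⇒>; <⇒≱; m≤n⇒m≤1+n; m≤m+n; m≤n+m; _<?_; _≤?_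
        ; +-mono-≤; *-mono-≤; *-monoʳ-≤; *-monoˡ-<; *-cancelˡ-<; ∸-monoˡ-≤; m+[n∸m]≡n
        ; *-identityʳ; *-assoc; *-comm; m^n>0; ^-*-assoc; ^-distribˡ-+-*; ^-monoʳ-<
        ; +-*-semiring; module ≤-Reasoning )
import Data.Nat.Properties as ℕ
open import Data.Nat.Tactic.RingSolver using (solve-∀)
open import Data.Product using (∃; _,_; proj₁; proj₂; _×_; uncurry′)
open import Data.Vec.Base using (Vec; []; _∷_; replicate; updateAt)
open import Data.Vec.Properties using (∷-injectiveˡ; ∷-injectiveʳ; ≡-dec)
open import Data.Vec.Relation.Unary.All as All using (All; []; _∷_)
open import Function.Base using (_∘_)
open import Function.Bundles using (Equivalence)
open import Function.Definitions using (Injective)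
open import Relation.Binary.Definitions using (DecidableEquality)
open import Relation.Binary.PropositionalEquality as ≡ using (_≡_; refl; cong; cong₂; module ≡-Reasoning)
open import Relation.Nullary using (Dec; yes; no; does; ¬_)
open import Relation.Nullary.Decidable using (dec-true)
open import Relation.Unary using (_⊆_)
open import Algebra.Properties.Semiring.Sum +-*-semiring
  using (sum; sum-syntax; sum-cong-≗; ∑-comm; *-distribˡ-sum; sum-replicate-zero)

⟦_⟧ : Bool → ℕ
⟦ true ⟧  = 1
⟦ false ⟧ = 0

⟦⟧≤1 : ∀ b → ⟦ b ⟧ ≤ 1
⟦⟧≤1 true  = ≤-refl
⟦⟧≤1 false = z≤n

0<⟦⟧⇒T : ∀ b → 0 < ⟦ b ⟧ → T b
0<⟦⟧⇒T true _ = _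

T-does⇒ : ∀ {a} {P : Set a} (P? : Dec P) → T (does P?) → P
T-does⇒ (yes p) _ = p

T⇒1≤⟦⟧ : ∀ {b} → T b → 1 ≤ ⟦ b ⟧
T⇒1≤⟦⟧ {true} _ = ≤-refl

⟦⟧≤ : ∀ b {x} → (T b → 1 ≤ x) → ⟦ b ⟧ ≤ x
⟦⟧≤ true  1≤x = 1≤x _
⟦⟧≤ false _   = z≤n

T-does⇐ : ∀ {a} {P : Set a} (P? : Dec P) → P → T (does P?)
T-does⇐ P? p = Equivalence.from T-≡ (dec-true P? p)

⟦∧⟧≤⟦⟧ʳ : ∀ a b → ⟦ a ∧ b ⟧ ≤ ⟦ b ⟧
⟦∧⟧≤⟦⟧ʳ true  b = ≤-refl
⟦∧⟧≤⟦⟧ʳ false b = z≤n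

m≤n⇒m≤n*⟦0<m⟧ : ∀ {m n} → m ≤ n → m ≤ n * ⟦ does (0 <? m) ⟧
m≤n⇒m≤n*⟦0<m⟧ {zero}  _   = z≤n
m≤n⇒m≤n*⟦0<m⟧ {suc m} {n} m≤n = ≤-trans m≤n (≤-reflexive (≡.sym (*-identityʳ n)))

∑-mono-≤ : ∀ {n} {f g : Fin n → ℕ} → (∀ i → f i ≤ g i) → sum f ≤ sum g
∑-mono-≤ {zero}  _   = z≤n
∑-mono-≤ {suc n} f≤g = +-mono-≤ (f≤g zero) (∑-mono-≤ (f≤g ∘ suc))

∑-const : ∀ n x → ∑[ i < n ] x ≡ n * x
∑-const zero    x = refl
∑-const (suc n) x = cong (x +_) (∑-const n x)

f≤∑f : ∀ {n} (f : Fin n → ℕ) i → f i ≤ sum f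
f≤∑f f zero    = m≤m+n _ _
f≤∑f f (suc i) = ≤-trans (f≤∑f (f ∘ suc) i) (m≤n+m _ _)

0<∑⇒∃0< : ∀ {n} (f : Fin n → ℕ) → 0 < sum f → ∃ λ i → 0 < f i
0<∑⇒∃0< {suc n} f 0<∑ with f zero in f₀≡
... | suc _ = zero , ≡.subst (0 <_) (≡.sym f₀≡) (s≤s z≤n)
... | zero with 0<∑⇒∃0< (f ∘ suc) 0<∑
...   | i , 0<fi = suc i , 0<fi

∑⟦⟧≤ : ∀ {n} (B : Fin n → Bool) → ∑[ i < n ] ⟦ B i ⟧ ≤ n
∑⟦⟧≤ {n} B = begin
  ∑[ i < n ] ⟦ B i ⟧  ≤⟨ ∑-mono-≤ (λ i → ⟦⟧≤1 (B i)) ⟩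
  ∑[ i < n ] 1        ≡⟨ ∑-const n 1 ⟩
  n * 1               ≡⟨ *-identityʳ n ⟩
  n                   ∎
  where open ≤-Reasoning

∑⟦j≟i⟧≡1 : ∀ {n} (i : Fin n) → ∑[ j < n ] ⟦ does (j ≟ᶠ i) ⟧ ≡ 1
∑⟦j≟i⟧≡1 {suc n} zero    = cong suc (sum-replicate-zero n)
∑⟦j≟i⟧≡1 {suc n} (suc i) = ∑⟦j≟i⟧≡1 i

module _ {A : Set} (_≟_ : DecidableEquality A) where

  injective⇒∑⟦e≟w⟧≤1 : ∀ {n} {e : Fin n → A} → Injective _≡_ _≡_ e →
                       ∀ w → ∑[ c < n ] ⟦ does (e c ≟ w) ⟧ ≤ 1
  injective⇒∑⟦e≟w⟧≤1 {n} {e} e-inj w with 0 <? ∑[ c < n ] ⟦ does (e c ≟ w) ⟧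
  ... | no  ∑≯0 = ≤-trans (≮⇒≥ ∑≯0) z≤n
  ... | yes 0<∑ with 0<∑⇒∃0< _ 0<∑
  ...   | c₀ , 0<term = begin
    ∑[ c < n ] ⟦ does (e c ≟ w) ⟧  ≤⟨ ∑-mono-≤ (λ c → at-most-c₀ c (e c ≟ w)) ⟩
    ∑[ c < n ] ⟦ does (c ≟ᶠ c₀) ⟧  ≡⟨ ∑⟦j≟i⟧≡1 c₀ ⟩
    1                              ∎
    where
    open ≤-Reasoning
    ec₀≡w : e c₀ ≡ w
    ec₀≡w = T-does⇒ (e c₀ ≟ w) (0<⟦⟧⇒T _ 0<term)
    at-most-c₀ : ∀ c (ec≟w : Dec (e c ≡ w)) → ⟦ does ec≟w ⟧ ≤ ⟦ does (c ≟ᶠ c₀) ⟧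
    at-most-c₀ c (yes ec≡w) = ≤-reflexive (≡.sym (cong ⟦_⟧ (dec-true (c ≟ᶠ c₀) (e-inj (≡.trans ec≡w (≡.sym ec₀≡w))))))
    at-most-c₀ c (no _)     = z≤n

≤∑⟦⟧⇒injection : ∀ {m} k (B : Fin m → Bool) → k ≤ ∑[ i < m ] ⟦ B i ⟧ →
                 ∃ λ (f : Fin k → Fin m) → Injective _≡_ _≡_ f × (∀ t → T (B (f t)))
≤∑⟦⟧⇒injection zero B _ = (λ ()) , (λ { {()} }) , (λ ())
≤∑⟦⟧⇒injection {suc m} (suc k) B k<∑ with B zero in B₀≡
... | true with ≤∑⟦⟧⇒injection k (B ∘ suc) (s≤s⁻¹ k<∑)
...   | f , f-inj , Bf = f′ , f′-inj , Bf′
  where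
  f′ : Fin (suc k) → Fin (suc m)
  f′ zero    = zero
  f′ (suc t) = suc (f t)
  f′-inj : Injective _≡_ _≡_ f′
  f′-inj {zero}  {zero}  _  = refl
  f′-inj {suc t} {suc u} eq = cong suc (f-inj (suc-injective eq))
  Bf′ : ∀ t → T (B (f′ t))
  Bf′ zero    = Equivalence.from T-≡ B₀≡
  Bf′ (suc t) = Bf t
≤∑⟦⟧⇒injection {suc m} (suc k) B k<∑ | false with ≤∑⟦⟧⇒injection (suc k) (B ∘ suc) k<∑
... | f , f-inj , Bf = suc ∘ f , f-inj ∘ suc-injective , Bf

box : ∀ M R → Fin (suc M ^ R) → Vec ℕ R
box M zero    _ = []
box M (suc R) c = toℕ (proj₁ digit,rest) ∷ box M R (proj₂ digit,rest)
  where
  digit,rest : Fin (suc M) × Fin (suc M ^ R)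
  digit,rest = remQuot {suc M} (suc M ^ R) c

box-injective : ∀ M R → Injective _≡_ _≡_ (box M R)
box-injective M zero    {zero} {zero} _ = refl
box-injective M (suc R) {c} {c′} eq = begin
  c                                        ≡⟨ combine-remQuot {suc M} (suc M ^ R) c ⟨
  uncurry′ combine (remQuot {suc M} _ c)   ≡⟨ cong₂ combine (toℕ-injective (∷-injectiveˡ eq))
                                                            (box-injective M R (∷-injectiveʳ eq)) ⟩
  uncurry′ combine (remQuot {suc M} _ c′)  ≡⟨ combine-remQuot {suc M} (suc M ^ R) c′ ⟩
  c′                                       ∎
  where open ≡-Reasoning

box-surjective : ∀ {M R} (v : Vec ℕ R) → All (_≤ M) v → ∃ λ c → box M R c ≡ v
box-surjective []      []            = zero , refl
box-surjective {M} {suc R} (x ∷ v) (x≤M ∷ v≤M) with box-surjective v v≤M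
... | c , box-c≡v = combine x′ c , (begin
  box M (suc R) (combine x′ c)  ≡⟨ cong (λ p → toℕ (proj₁ p) ∷ box M R (proj₂ p)) (remQuot-combine x′ c) ⟩
  toℕ x′ ∷ box M R c            ≡⟨ cong₂ _∷_ (toℕ-fromℕ< (s≤s x≤M)) box-c≡v ⟩
  x ∷ v                         ∎)
  where
  open ≡-Reasoning
  x′ : Fin (suc M)
  x′ = fromℕ< (s≤s x≤M)

updateAt-injective : ∀ {A : Set} {R} (r : Fin R) {f : A → A} →
                     Injective _≡_ _≡_ f → Injective _≡_ _≡_ (λ v → updateAt v r f)
updateAt-injective zero    f-inj {x ∷ v} {y ∷ w} eq =
  cong₂ _∷_ (f-inj (∷-injectiveˡ eq)) (∷-injectiveʳ eq)
updateAt-injective (suc r) f-inj {x ∷ v} {y ∷ w} eq =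
  cong₂ _∷_ (∷-injectiveˡ eq) (updateAt-injective r f-inj (∷-injectiveʳ eq))

updateAt-suc-bounded : ∀ {R n} (r : Fin R) {v : Vec ℕ R} → All (_≤ n) v → All (_≤ suc n) (updateAt v r suc)
updateAt-suc-bounded zero    (x≤n ∷ v≤n) = s≤s x≤n ∷ All.map m≤n⇒m≤1+n v≤n
updateAt-suc-bounded (suc r) (x≤n ∷ v≤n) = m≤n⇒m≤1+n x≤n ∷ updateAt-suc-bounded r v≤n

replicate-zero-bounded : ∀ {R n} → All (_≤ n) (replicate R 0)
replicate-zero-bounded {zero}  = []
replicate-zero-bounded {suc R} = z≤n ∷ replicate-zero-bounded

2*K<m⇒m*x≤K*y⇒2*x≤y : ∀ {K m x y} → 2 * K < m → 0 < x → m * x ≤ K * y → 2 * x ≤ y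
2*K<m⇒m*x≤K*y⇒2*x≤y {K} {m} {x} {y} 2K<m 0<x mx≤Ky = <⇒≤ (*-cancelˡ-< K (2 * x) y (begin-strict
  K * (2 * x)  ≡⟨ *-assoc K 2 x ⟨
  K * 2 * x    ≡⟨ cong (_* x) (*-comm K 2) ⟩
  2 * K * x    <⟨ *-monoˡ-< x {{>-nonZero 0<x}} 2K<m ⟩
  m * x        ≤⟨ mx≤Ky ⟩
  K * y        ∎))
  where open ≤-Reasoning

n<2^n : ∀ n → n < 2 ^ n
n<2^n zero    = s≤s z≤n
n<2^n (suc n) = +-mono-≤ (m^n>0 2 n) (≤-trans (n<2^n n) (m≤m+n (2 ^ n) 0))

square-expansion : ∀ R → 2 + (1 + 2 * R + (1 + 2 * R)) * R + (6 * R + 2) ≡ (2 + 2 * R) * (2 + 2 * R)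
square-expansion = solve-∀

exponential-beats-polynomial : ∀ R → ∃ λ M → suc M ^ R < 2 ^ M
exponential-beats-polynomial R = 2 ^ t ∸ 1 , (begin-strict
  suc (2 ^ t ∸ 1) ^ R  ≡⟨ cong (_^ R) (m+[n∸m]≡n (m^n>0 2 t)) ⟩
  (2 ^ t) ^ R          ≡⟨ ^-*-assoc 2 t R ⟩
  2 ^ (t * R)          <⟨ ^-monoʳ-< 2 (s≤s (s≤s z≤n)) (∸-monoˡ-≤ 1 2+tR≤2^t) ⟩
  2 ^ (2 ^ t ∸ 1)      ∎)
  where
  open ≤-Reasoning
  s t : ℕ
  s = 1 + 2 * R
  t = s + s
  2+tR≤2^t : 2 + t * R ≤ 2 ^ t
  2+tR≤2^t = begin
    2 + t * R                   ≤⟨ m≤m+n _ _ ⟩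
    2 + t * R + (6 * R + 2)     ≡⟨ square-expansion R ⟩
    suc s * suc s               ≤⟨ *-mono-≤ (n<2^n s) (n<2^n s) ⟩
    2 ^ s * 2 ^ s               ≡⟨ ^-distribˡ-+-* 2 s s ⟨
    2 ^ t                       ∎

double-counting : ∀ {m s t l K} (S : Fin s → Bool) (S′ : Fin t → Bool) (W : Fin m → Fin s → Fin t → ℕ) →
  (∀ i c → ⟦ S c ⟧ ≤ ∑[ u < t ] W i c u) →
  (∀ i u → ∑[ c < s ] W i c u ≤ l) →
  (∀ u → ∑[ i < m ] ⟦ does (0 <? ∑[ c < s ] W i c u) ⟧ ≤ K * ⟦ S′ u ⟧) →
  m * ∑[ c < s ] ⟦ S c ⟧ ≤ (l * K) * ∑[ u < t ] ⟦ S′ u ⟧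
double-counting {m} {s} {t} {l} {K} S S′ W row column overlaps = begin
  m * ∑[ c < s ] ⟦ S c ⟧                       ≡⟨ ∑-const m _ ⟨
  ∑[ i < m ] ∑[ c < s ] ⟦ S c ⟧                ≤⟨ ∑-mono-≤ (λ i → ∑-mono-≤ (row i)) ⟩
  ∑[ i < m ] ∑[ c < s ] ∑[ u < t ] W i c u     ≡⟨ sum-cong-≗ (λ i → ∑-comm (W i)) ⟩
  ∑[ i < m ] ∑[ u < t ] ∑[ c < s ] W i c u     ≤⟨ ∑-mono-≤ (λ i → ∑-mono-≤ (λ u → m≤n⇒m≤n*⟦0<m⟧ (column i u))) ⟩
  ∑[ i < m ] ∑[ u < t ] (l * ⟦ hit i u ⟧)      ≡⟨ ∑-comm (λ i u → l * ⟦ hit i u ⟧) ⟩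
  ∑[ u < t ] ∑[ i < m ] (l * ⟦ hit i u ⟧)      ≡⟨ sum-cong-≗ (λ u → *-distribˡ-sum l (λ i → ⟦ hit i u ⟧)) ⟨
  ∑[ u < t ] (l * ∑[ i < m ] ⟦ hit i u ⟧)      ≤⟨ ∑-mono-≤ (λ u → *-monoʳ-≤ l (overlaps u)) ⟩
  ∑[ u < t ] (l * (K * ⟦ S′ u ⟧))              ≡⟨ sum-cong-≗ (λ u → *-assoc l K ⟦ S′ u ⟧) ⟨
  ∑[ u < t ] (l * K * ⟦ S′ u ⟧)                ≡⟨ *-distribˡ-sum (l * K) (λ u → ⟦ S′ u ⟧) ⟨
  l * K * ∑[ u < t ] ⟦ S′ u ⟧                  ∎
  where
  open ≤-Reasoning
  hit : Fin m → Fin t → Bool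
  hit i u = does (0 <? ∑[ c < s ] W i c u)

module _ {c ℓ} (G : AbelianGroup c ℓ) where
  open AbelianGroup G renaming (refl to ≈-refl; sym to ≈-sym; trans to ≈-trans)
  open import Algebra.Definitions.RawMonoid rawMonoid using () renaming (_×_ to _·_)
  open import Algebra.Properties.CommutativeSemigroup commutativeSemigroup using (xy∙z≈yz∙x)

  combination : ∀ {R} → (Fin R → Carrier) → Vec ℕ R → Carrier
  combination h []      = ε
  combination h (x ∷ v) = x · h zero ∙ combination (h ∘ suc) v

  combination-updateAt-suc : ∀ {R} (h : Fin R → Carrier) r v →
                             combination h (updateAt v r suc) ≈ combination h v ∙ h r
  combination-updateAt-suc h zero    (x ∷ v) = xy∙z≈yz∙x (h zero) (x · h zero) (combination (h ∘ suc) v)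
  combination-updateAt-suc h (suc r) (x ∷ v) =
    ≈-trans (∙-congˡ (combination-updateAt-suc (h ∘ suc) r v)) (≈-sym (assoc _ _ _))

  combination-replicate-zero : ∀ {R} (h : Fin R → Carrier) → combination h (replicate R 0) ≈ ε
  combination-replicate-zero {zero}  h = ≈-refl
  combination-replicate-zero {suc R} h = ≈-trans (identityˡ _) (combination-replicate-zero (h ∘ suc))

  fewer-than-k-members : ∀ {p m k} {X : Fin m → Subset G p} → EveryKDisjoint G k X →
                         ∀ {y} (B : Fin m → Bool) → (∀ i → T (B i) → mem (X i) y) → ∑[ i < m ] ⟦ B i ⟧ < k
  fewer-than-k-members {k = k} disjoint B B⇒∈ = ≰⇒> λ k≤∑ →
    let (f , f-inj , Bf) = ≤∑⟦⟧⇒injection k B k≤∑ in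
    disjoint f f-inj (_ , λ t → B⇒∈ (f t) (Bf t))

  empty-distinct-family : ∀ {p m} {X : Fin m → Subset G p} →
                          PairwiseDistinct G X → (∀ i {x} → ¬ mem (X i) x) → m ≤ 1
  empty-distinct-family {m = zero}          _        _     = z≤n
  empty-distinct-family {m = suc zero}      _        _     = ≤-refl
  empty-distinct-family {m = suc (suc m)} distinct empty =
    ⊥-elim (distinct zero (suc zero) (λ ()) (⊥-elim ∘ empty zero , ⊥-elim ∘ empty (suc zero)))

module Growth {c ℓ p q} (G : AbelianGroup c ℓ) (A : Subset G q) {m l k : ℕ} (X : Fin m → Subset G p)
  (X⊆A : ∀ i → mem (X i) ⊆ mem A) (covers : ∀ i → CoveredByTranslates G l A (X i))
  (disjoint : EveryKDisjoint G k X) {a} (a∈A : mem A a) (M : ℕ) where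

  open AbelianGroup G renaming (refl to ≈-refl; sym to ≈-sym; trans to ≈-trans)
  open import Algebra.Properties.AbelianGroup G using (xyx⁻¹≈y)

  R : ℕ
  R = m * l

  g : Fin m → Fin l → Carrier
  g i = proj₁ (covers i)

  h : Fin R → Carrier
  h r = uncurry′ g (remQuot l r) ⁻¹

  -- point v = a − Σ v(i,j) g i j, with v(i,j) stored at index combine i j
  point : Vec ℕ R → Carrier
  point v = a ∙ combination G h v

  step : Fin m → Fin l → Vec ℕ R → Vec ℕ R
  step i j v = updateAt v (combine i j) suc

  point-step : ∀ i j v → point (step i j v) ≈ point v ∙ g i j ⁻¹
  point-step i j v = begin
    a ∙ combination G h (step i j v)           ≈⟨ ∙-congˡ (combination-updateAt-suc G h (combine i j) v) ⟩
    a ∙ (combination G h v ∙ h (combine i j))  ≈⟨ assoc _ _ _ ⟨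
    point v ∙ h (combine i j)                  ≡⟨ cong (λ ij → point v ∙ uncurry′ g ij ⁻¹) (remQuot-combine i j) ⟩
    point v ∙ g i j ⁻¹                         ∎
    where open import Relation.Binary.Reasoning.Setoid setoid

  step-into : ∀ i {v} → mem A (point v) → ∃ λ j → mem (X i) (point (step i j v))
  step-into i {v} v∈A with proj₂ (covers i) (point v) v∈A
  ... | j , x , x∈X , v≈gx = j , resp (X i) (≈-sym (begin
    point (step i j v)    ≈⟨ point-step i j v ⟩
    point v ∙ g i j ⁻¹    ≈⟨ ∙-congʳ v≈gx ⟩
    g i j ∙ x ∙ g i j ⁻¹  ≈⟨ xyx⁻¹≈y (g i j) x ⟩
    x                     ∎)) x∈X
    where open import Relation.Binary.Reasoning.Setoid setoid

  direction : Fin m → ∀ v (b : Bool) → (T b → mem A (point v)) → Fin l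
  direction i v true  v∈A = proj₁ (step-into i {v} (v∈A _))
  direction i _ false _   = proj₁ (proj₂ (covers i) a a∈A)   -- off S the choice is irrelevant

  direction-into : ∀ i v b (v∈A : T b → mem A (point v)) → T b →
                   mem (X i) (point (step i (direction i v b v∈A) v))
  direction-into i v true v∈A _ = proj₂ (step-into i {v} (v∈A _))

  s : ℕ
  s = suc M ^ R

  cell : Fin s → Vec ℕ R
  cell = box M R

  _≟ⱽ_ : DecidableEquality (Vec ℕ R)
  _≟ⱽ_ = ≡-dec ℕ._≟_

  record Stage (n : ℕ) : Set q where
    field
      S         : Fin s → Bool
      S⊆A       : ∀ c → T (S c) → mem A (point (cell c))
      S-bounded : ∀ c → T (S c) → All (_≤ n) (cell c)

  size : ∀ {n} → Stage n → ℕ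
  size σ = ∑[ c < s ] ⟦ Stage.S σ c ⟧

  module _ {n} (σ : Stage n) where
    open Stage σ

    successor : Fin m → Fin s → Vec ℕ R
    successor i c = step i (direction i (cell c) (S c) (S⊆A c)) (cell c)

    reaches : Fin m → Fin s → Fin s → ℕ
    reaches i c u = ⟦ S c ∧ does (successor i c ≟ⱽ cell u) ⟧

    hit : Fin m → Fin s → Bool
    hit i u = does (0 <? ∑[ c < s ] reaches i c u)

    S⁺ : Fin s → Bool
    S⁺ u = does (0 <? ∑[ i < m ] ⟦ hit i u ⟧)

    hit⇒ : ∀ i u → T (hit i u) → ∃ λ c → T (S c) × successor i c ≡ cell u
    hit⇒ i u hit-iu
      with 0<∑⇒∃0< (λ c → reaches i c u) (T-does⇒ (0 <? ∑[ c < s ] reaches i c u) hit-iu)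
    ... | c , 0<reaches with Equivalence.to T-∧ (0<⟦⟧⇒T _ 0<reaches)
    ...   | Sc , succ≡cell = c , Sc , T-does⇒ (successor i c ≟ⱽ cell u) succ≡cell

    hit-into : ∀ i u → T (hit i u) → mem (X i) (point (cell u))
    hit-into i u hit-iu with hit⇒ i u hit-iu
    ... | c , Sc , succ≡cell =
      ≡.subst (mem (X i) ∘ point) succ≡cell (direction-into i (cell c) (S c) (S⊆A c) Sc)

    S⁺⇒hit : ∀ u → T (S⁺ u) → ∃ λ i → T (hit i u)
    S⁺⇒hit u S⁺u
      with 0<∑⇒∃0< (λ i → ⟦ hit i u ⟧) (T-does⇒ (0 <? ∑[ i < m ] ⟦ hit i u ⟧) S⁺u)
    ... | i , 0<hit = i , 0<⟦⟧⇒T _ 0<hit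

    successor-bounded : ∀ i c → T (S c) → All (_≤ suc n) (successor i c)
    successor-bounded i c Sc = updateAt-suc-bounded _ (S-bounded c Sc)

    next : Stage (suc n)
    next = record
      { S         = S⁺
      ; S⊆A       = λ u S⁺u → let (i , hit-iu) = S⁺⇒hit u S⁺u in X⊆A i (hit-into i u hit-iu)
      ; S-bounded = λ u S⁺u → let (i , hit-iu) = S⁺⇒hit u S⁺u
                                  (c , Sc , succ≡cell) = hit⇒ i u hit-iu
                              in ≡.subst (All (_≤ suc n)) succ≡cell (successor-bounded i c Sc)
      }

    grow : suc n ≤ M → m * size σ ≤ l * (k ∸ 1) * size next
    grow n<M = double-counting S S⁺ reaches row column overlaps
      where
      row : ∀ i c → ⟦ S c ⟧ ≤ ∑[ u < s ] reaches i c u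
      row i c = ⟦⟧≤ (S c) λ Sc →
        let (u , cell-u≡) = box-surjective (successor i c)
                                           (All.map (λ ≤n → ≤-trans ≤n n<M) (successor-bounded i c Sc))
            reaches-u     = Equivalence.from T-∧ (Sc , T-does⇐ (successor i c ≟ⱽ cell u) (≡.sym cell-u≡))
        in ≤-trans (T⇒1≤⟦⟧ reaches-u) (f≤∑f _ u)

      column : ∀ i u → ∑[ c < s ] reaches i c u ≤ l
      column i u = begin
        ∑[ c < s ] reaches i c u                               ≤⟨ ∑-mono-≤ (λ c → ⟦∧⟧≤⟦⟧ʳ (S c) _) ⟩
        ∑[ c < s ] ⟦ does (successor i c ≟ⱽ cell u) ⟧          ≤⟨ ∑-mono-≤ (λ c → f≤∑f (λ j → lands j c) _) ⟩
        ∑[ c < s ] ∑[ j < l ] lands j c                        ≡⟨ ∑-comm (λ c j → lands j c) ⟩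
        ∑[ j < l ] ∑[ c < s ] lands j c                        ≤⟨ ∑-mono-≤ (λ j → injective⇒∑⟦e≟w⟧≤1 _≟ⱽ_ (step-injective j) (cell u)) ⟩
        ∑[ j < l ] 1                                           ≡⟨ ∑-const l 1 ⟩
        l * 1                                                  ≡⟨ *-identityʳ l ⟩
        l                                                      ∎
        where
        open ≤-Reasoning
        lands : Fin l → Fin s → ℕ
        lands j c = ⟦ does (step i j (cell c) ≟ⱽ cell u) ⟧
        step-injective : ∀ j → Injective _≡_ _≡_ (step i j ∘ cell)
        step-injective j = box-injective M R ∘ updateAt-injective (combine i j) ℕ.suc-injective

      overlaps : ∀ u → ∑[ i < m ] ⟦ hit i u ⟧ ≤ (k ∸ 1) * ⟦ S⁺ u ⟧
      overlaps u = m≤n⇒m≤n*⟦0<m⟧ (∸-monoˡ-≤ 1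
        (fewer-than-k-members G {X = X} disjoint (λ i → hit i u) (λ i → hit-into i u)))

  origin : Stage 0
  origin = record
    { S         = λ c → does (cell c ≟ⱽ replicate R 0)
    ; S⊆A       = λ c Sc → resp A (≈-sym (point≈a (cell≡0 c Sc))) a∈A
    ; S-bounded = λ c Sc → ≡.subst (All (_≤ 0)) (≡.sym (cell≡0 c Sc)) replicate-zero-bounded
    }
    where
    cell≡0 : ∀ c → T (does (cell c ≟ⱽ replicate R 0)) → cell c ≡ replicate R 0
    cell≡0 c = T-does⇒ (cell c ≟ⱽ replicate R 0)
    point≈a : ∀ {v} → v ≡ replicate R 0 → point v ≈ a
    point≈a refl = ≈-trans (∙-congˡ (combination-replicate-zero G h)) (identityʳ a)

  1≤size-origin : 1 ≤ size origin
  1≤size-origin with box-surjective {M} (replicate R 0) replicate-zero-bounded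
  ... | c , cell-c≡0 = ≤-trans (T⇒1≤⟦⟧ (T-does⇐ (cell c ≟ⱽ replicate R 0) cell-c≡0)) (f≤∑f _ c)

  stage : ∀ n → Stage n
  stage zero    = origin
  stage (suc n) = next (stage n)

  2^n≤size : 2 * (l * (k ∸ 1)) < m → ∀ n → n ≤ M → 2 ^ n ≤ size (stage n)
  2^n≤size 2K<m zero    _   = 1≤size-origin
  2^n≤size 2K<m (suc n) n<M = ≤-trans (*-monoʳ-≤ 2 ih)
    (2*K<m⇒m*x≤K*y⇒2*x≤y {l * (k ∸ 1)} 2K<m (≤-trans (m^n>0 2 n) ih) (grow (stage n) n<M))
    where
    ih : 2 ^ n ≤ size (stage n)
    ih = 2^n≤size 2K<m n (<⇒≤ n<M)

  m≤2l[k∸1] : s < 2 ^ M → m ≤ 2 * (l * (k ∸ 1))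
  m≤2l[k∸1] s<2^M = ≮⇒≥ λ 2K<m →
    <⇒≱ s<2^M (≤-trans (2^n≤size 2K<m M ≤-refl) (∑⟦⟧≤ (Stage.S (stage M))))

inhabited⇒m≤2l[k∸1] : ∀ {c ℓ p q} (G : AbelianGroup c ℓ) (A : Subset G q) {m l k} (X : Fin m → Subset G p) →
  (∀ i → mem (X i) ⊆ mem A) → (∀ i → CoveredByTranslates G l A (X i)) → EveryKDisjoint G k X →
  ∀ {a} → mem A a → m ≤ 2 * (l * (k ∸ 1))
inhabited⇒m≤2l[k∸1] G A {m} {l} X X⊆A covers disjoint a∈A =
  let (M , M-large) = exponential-beats-polynomial (m * l)
  in Growth.m≤2l[k∸1] G A X X⊆A covers disjoint a∈A M M-large

m≤1+2l[k∸1] : ∀ {c ℓ p q} (G : AbelianGroup c ℓ) (A : Subset G q) {m l k} (X : Fin m → Subset G p) →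
  (∀ i → mem (X i) ⊆ mem A) → (∀ i → CoveredByTranslates G l A (X i)) →
  PairwiseDistinct G X → EveryKDisjoint G k X → m ≤ suc (2 * (l * (k ∸ 1)))
m≤1+2l[k∸1] G A {m} {l} {k} X X⊆A covers distinct disjoint with m ≤? 2 * (l * (k ∸ 1))
... | yes m≤2K = m≤n⇒m≤1+n m≤2K
... | no  m≰2K = ≤-trans (empty-distinct-family G {X = X} distinct X-empty) (s≤s z≤n)
  where
  X-empty : ∀ i {x} → ¬ mem (X i) x
  X-empty i x∈X = m≰2K (inhabited⇒m≤2l[k∸1] G A X X⊆A covers disjoint (X⊆A i x∈X))

lemma2p7 : {c ℓ p q : Level} (k l : ℕ) → 1 ≤ k → 1 ≤ l →
    ∃ λ (N : ℕ) →
      (G : AbelianGroup c ℓ) (A : Subset G q) (m : ℕ) (X : Fin m → Subset G p) →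
      (∀ i → mem (X i) ⊆ mem A) →
      (∀ i → CoveredByTranslates G l A (X i)) →
      PairwiseDistinct G X →
      EveryKDisjoint G k X →
      m ≤ N
lemma2p7 k l _ _ = suc (2 * (l * (k ∸ 1))) , λ G A m X → m≤1+2l[k∸1] G A X
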